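{- Every provable U-Turn judgment is valid: for every IL proof tree $d$ with conclusion $[P]\,\mathsf{r}\,[Q]$ and all assertions $P',Q'$, if the judgment $d \vdash \langle P'\rangle\,\mathsf{r}\,\langle Q'\rangle$ is derivable with the U-Turn rules, then (1) the SIL triple $\langle P'\rangle\,\mathsf{r}\,\langle Q'\rangle$ is valid, (2) $P'\subseteq P$, (3) $Q'\subseteq Q$, and (4) either $P'=Q'=\varnothing$ or both $P'\neq\varnothing$ and $Q'\neq\varnothing$.
   Context: Language: arithmetic expressions $a$ and Boolean expressions $b$ are standard; atomic commands $\mathsf{c} ::= \mathtt{skip}\mid x:=a\mid b?\mid x:=\mathtt{nondet()}$; regular commands $\mathsf{r}::=\mathsf{c}\mid\mathsf{r};\mathsf{r}\mid\mathsf{r}\boxplus\mathsf{r}\mid\mathsf{r}^*$. States are pairs of a flag in $\{ok,er\}$ and a store $\sigma:\mathrm{Var}\to\mathbb{Z}$ ($\mathrm{Var}$ finite). Forward semantics on ok-states: $[\![\mathtt{skip}]\!]\sigma=\{\sigma\}$, $[\![x:=a]\!]\sigma=\{\sigma[x\mapsto[\![a]\!]\sigma]\}$, $[\![b?]\!]\sigma=\{\sigma\}$ if $b$ holds in $\sigma$ else $\varnothing$, $[\![x:=\mathtt{nondet()}]\!]\sigma=\{\sigma[x\mapsto v]\mid v\in\mathbb{Z}\}$ (results ok-tagged); every command maps an er-state $\sigma$ to $\{\sigma\}$; $[\![\mathsf{r}_1;\mathsf{r}_2]\!]\sigma=[\![\mathsf{r}_2]\!]([\![\mathsf{r}_1]\!]\sigma)$,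 $[\![\mathsf{r}_1\boxplus\mathsf{r}_2]\!]\sigma=[\![\mathsf{r}_1]\!]\sigma\cup[\![\mathsf{r}_2]\!]\sigma$, $[\![\mathsf{r}^*]\!]\sigma=\bigcup_{n\ge0}[\![\mathsf{r}]\!]^n\sigma$; all lifted to sets by union. Backward semantics $\overleftarrow{[\![\mathsf{r}]\!]}\sigma'=\{\sigma\mid\sigma'\in[\![\mathsf{r}]\!]\sigma\}$, lifted by union. Assertions are sets of states; $\land,\lor,\implies,\text{false}$ are intersection, union, inclusion, $\varnothing$. For a set of stores $P$: $ok{:}P$ (resp. $er{:}P$) is the set of ok- (resp. er-)tagged states whose store is in $P$; $P[a/x]=\{\sigma\mid\sigma[x\mapsto[\![a]\!]\sigma]\in P\}$; $\exists x.P=\{\sigma[x\mapsto v]\mid\sigma\in P, v\in\mathbb{Z}\}$; $\mathrm{sp}_{x:=a}(P)=\{\sigma[x\mapsto[\![a]\!]\sigma]\mid\sigma\in P\}$. SIL triple $\langle P\rangle\mathsf{r}\langle Q\rangle$ is valid iff $P\subseteq\overleftarrow{[\![\mathsf{r}]\!]}Q$; IL triple $[P]\mathsf{r}[Q]$ valid iff $Q\subseteq[\![\mathsf{r}]\!]P$. IL proof trees are built from the rules: (assign) $[ok{:}P]\,x:=a\,[ok{:}\mathrm{sp}_{x:=a}(P)]$; (assume) $[ok{:}P]\,b?\,[ok{:}P\land b]$; (nondet) $[ok{:}P]\,x:=\mathtt{nondet()}\,[ok{:}\exists x.P]$; (skip) $[ok{:}P]\,\mathtt{skip}\,[ok{:}P]$;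 (er-id) $[er{:}P]\,\mathsf{r}\,[er{:}P]$; (disj) from $[P_1]\mathsf{r}[Q_1]$ and $[P_2]\mathsf{r}[Q_2]$ infer $[P_1\lor P_2]\mathsf{r}[Q_1\lor Q_2]$; (cons) from $[P']\mathsf{r}[Q']$ with $P'\implies P$ and $Q\implies Q'$ infer $[P]\mathsf{r}[Q]$; (seq) from $[P]\mathsf{r}_1[R]$ and $[R]\mathsf{r}_2[Q]$ infer $[P]\mathsf{r}_1;\mathsf{r}_2[Q]$; (choiceL/R) from $[P]\mathsf{r}_i[Q]$ infer $[P]\mathsf{r}_1\boxplus\mathsf{r}_2[Q]$ ($i=1$ resp. $2$); (iter0) $[P]\mathsf{r}^*[P]$; (unroll) from $[P]\mathsf{r}^*;\mathsf{r}[Q]$ infer $[P]\mathsf{r}^*[Q]$. A U-Turn judgment $d\vdash\langle P'\rangle\mathsf{r}\langle Q'\rangle$ pairs an IL proof tree $d$ concluding $[P]\mathsf{r}[Q]$ with a SIL triple for the same $\mathsf{r}$. Its rules: (assign) if $d$ is the axiom $[ok{:}P]x:=a[ok{:}\mathrm{sp}_{x:=a}(P)]$ and $Q'\implies\mathrm{sp}_{x:=a}(P)$, then $d\vdash\langle ok{:}P\land Q'[a/x]\rangle x:=a\langle ok{:}Q'\rangle$; (nondet) if $d$ is the axiom $[ok{:}P]x:=\mathtt{nondet()}[ok{:}\exists x.P]$ and $Q'\implies\exists x.P$, then $d\vdash\langle ok{:}P\land\exists x.Q'\rangle x:=\mathtt{nondet()}\langle ok{:}Q'\rangle$; (assume)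 if $d$ is the axiom $[ok{:}P]b?[ok{:}P\land b]$ and $Q'\implies P\land b$, then $d\vdash\langle ok{:}Q'\rangle b?\langle ok{:}Q'\rangle$; (skip) if $d$ is the skip axiom with pre and post $P$ and $Q'\implies P$, then $d\vdash\langle Q'\rangle\mathtt{skip}\langle Q'\rangle$; (er-id) if $d$ is the axiom $[er{:}P]\mathsf{r}[er{:}P]$ and $Q'\implies P$, then $d\vdash\langle er{:}Q'\rangle\mathsf{r}\langle er{:}Q'\rangle$; (empty) for any $d$ concluding a triple for $\mathsf{r}$, $d\vdash\langle\text{false}\rangle\mathsf{r}\langle\text{false}\rangle$; (disj) if $d$ ends with IL (disj) with subtrees $d_1,d_2$, and $d_i\vdash\langle P_i'\rangle\mathsf{r}\langle Q_i'\rangle$ for $i=1,2$, then $d\vdash\langle P_1'\lor P_2'\rangle\mathsf{r}\langle Q_1'\lor Q_2'\rangle$; (seq) if $d$ ends with IL (seq) with subtrees $d_1$ (for $\mathsf{r}_1$) and $d_2$ (for $\mathsf{r}_2$), and $d_1\vdash\langle P'\rangle\mathsf{r}_1\langle R'\rangle$, $d_2\vdash\langle R'\rangle\mathsf{r}_2\langle Q'\rangle$, then $d\vdash\langle P'\rangle\mathsf{r}_1;\mathsf{r}_2\langle Q'\rangle$; (choiceL/R) if $d$ ends with IL (choiceL) (resp. choiceR) with subtree $d'$ and $d'\vdash\langle P'\rangle\mathsf{r}_1\langle Q'\rangle$ (resp. $\mathsf{r}_2$), then $d\vdash\langle P'\rangle\mathsf{r}_1\boxplus\mathsf{r}_2\langle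 Q'\rangle$; (iter0) if $d$ is the axiom $[P]\mathsf{r}^*[P]$ and $Q'\implies P$, then $d\vdash\langle Q'\rangle\mathsf{r}^*\langle Q'\rangle$; (unroll) if $d$ ends with IL (unroll) with subtree $d'$ and $d'\vdash\langle P'\rangle\mathsf{r}^*;\mathsf{r}\langle Q'\rangle$, then $d\vdash\langle P'\rangle\mathsf{r}^*\langle Q'\rangle$; (consIL) if $d$ ends with IL (cons) concluding $[P]\mathsf{r}[Q]$ from subtree $d'$, and $d'\vdash\langle P''\rangle\mathsf{r}\langle Q''\rangle$ with $Q''\implies Q$, then $d\vdash\langle P''\rangle\mathsf{r}\langle Q''\rangle$; (consSIL) if $d$ concludes $[P]\mathsf{r}[Q]$, $d\vdash\langle P''\rangle\mathsf{r}\langle Q''\rangle$, $\text{false}\not\equiv P'\implies P''$ and $Q''\implies Q'\implies Q$, then $d\vdash\langle P'\rangle\mathsf{r}\langle Q'\rangle$. -}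

module Defs where

open import Level using (0ℓ)
open import Data.Nat using (ℕ; zero; suc)
open import Data.Integer using (ℤ; _+_; _-_; _*_; _≤ᵇ_)
open import Data.Fin using (Fin)
open import Data.Vec using (Vec; lookup; _[_]≔_)
open import Data.Bool using (Bool; true; false; not; _∧_; _∨_)
open import Data.Product using (_×_; _,_; ∃; ∃-syntax)
open import Data.Empty using (⊥)
open import Relation.Nullary using (¬_; does)
open import Relation.Unary using (Pred; _∪_; _∩_; _⊆_; ∅; Empty)
open import Relation.Binary.PropositionalEquality using (_≡_)
import Data.Integer as ℤ

module Lang (k : ℕ) where

  Var : Set
  Var = Fin k

  -- stores σ : Var → ℤ, represented as vectors (Var is finite)
  Store : Set
  Store = Vec ℤ k

  data AExp : Set where
    num   : ℤ → AExp
    var   : Var → AExp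
    _⊕_   : AExp → AExp → AExp
    _⊖_   : AExp → AExp → AExp
    _⊗_   : AExp → AExp → AExp

  data BExp : Set where
    btrue bfalse : BExp
    _≤ₑ_ _=ₑ_    : AExp → AExp → BExp
    ¬ₑ_          : BExp → BExp
    _∧ₑ_ _∨ₑ_    : BExp → BExp → BExp

  evalA : AExp → Store → ℤ
  evalA (num n) σ = n
  evalA (var x) σ = lookup σ x
  evalA (a ⊕ b) σ = evalA a σ + evalA b σ
  evalA (a ⊖ b) σ = evalA a σ - evalA b σ
  evalA (a ⊗ b) σ = evalA a σ * evalA b σ

  evalB : BExp → Store → Bool
  evalB btrue σ = true
  evalB bfalse σ = false
  evalB (a ≤ₑ b) σ = evalA a σ ≤ᵇ evalA b σ
  evalB (a =ₑ b) σ = does (evalA a σ ℤ.≟ evalA b σ)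
  evalB (¬ₑ b) σ = not (evalB b σ)
  evalB (b ∧ₑ c) σ = evalB b σ ∧ evalB c σ
  evalB (b ∨ₑ c) σ = evalB b σ ∨ evalB c σ

  Holds : BExp → Pred Store 0ℓ
  Holds b σ = evalB b σ ≡ true

  data Cmd : Set where
    skip   : Cmd
    _≔_    : Var → AExp → Cmd
    _¿     : BExp → Cmd
    nondet : Var → Cmd

  data Reg : Set where
    atom : Cmd → Reg
    _⨾_  : Reg → Reg → Reg
    _⊞_  : Reg → Reg → Reg
    _⋆   : Reg → Reg

  data Flag : Set where
    ok er : Flag

  State : Set
  State = Flag × Store

  Assn : Set₁
  Assn = Pred State 0ℓ

  -- forward semantics as a relation: Sem r s t  iff  t ∈ [[r]] s
  mutual
    data Sem : Reg → State → State → Set where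
      skipS   : ∀ {σ} → Sem (atom skip) (ok , σ) (ok , σ)
      assignS : ∀ {σ x a} → Sem (atom (x ≔ a)) (ok , σ) (ok , σ [ x ]≔ evalA a σ)
      assumeS : ∀ {σ b} → Holds b σ → Sem (atom (b ¿)) (ok , σ) (ok , σ)
      nondetS : ∀ {σ x} (v : ℤ) → Sem (atom (nondet x)) (ok , σ) (ok , σ [ x ]≔ v)
      erS     : ∀ {σ c} → Sem (atom c) (er , σ) (er , σ)
      seqS    : ∀ {r₁ r₂ s t u} → Sem r₁ s t → Sem r₂ t u → Sem (r₁ ⨾ r₂) s u
      choiceLS : ∀ {r₁ r₂ s t} → Sem r₁ s t → Sem (r₁ ⊞ r₂) s t
      choiceRS : ∀ {r₁ r₂ s t} → Sem r₂ s t → Sem (r₁ ⊞ r₂) s t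
      starS   : ∀ {r s t} (n : ℕ) → Pow r n s t → Sem (r ⋆) s t

    data Pow (r : Reg) : ℕ → State → State → Set where
      pow0 : ∀ {s} → Pow r zero s s
      powS : ∀ {n s t u} → Pow r n s t → Sem r t u → Pow r (suc n) s u

  Back : Reg → Assn → Assn
  Back r Q s = ∃[ t ] (Q t × Sem r s t)

  SILValid : Assn → Reg → Assn → Set
  SILValid P r Q = P ⊆ Back r Q

  okA : Pred Store 0ℓ → Assn
  okA P (ok , σ) = P σ
  okA P (er , σ) = ⊥

  erA : Pred Store 0ℓ → Assn
  erA P (ok , σ) = ⊥
  erA P (er , σ) = P σ

  substA : Pred Store 0ℓ → AExp → Var → Pred Store 0ℓ
  substA P a x σ = P (σ [ x ]≔ evalA a σ)

  exA : Var → Pred Store 0ℓ → Pred Store 0ℓ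
  exA x P τ = ∃[ σ ] ∃[ v ] (P σ × τ ≡ σ [ x ]≔ v)

  sp : Var → AExp → Pred Store 0ℓ → Pred Store 0ℓ
  sp x a P τ = ∃[ σ ] (P σ × τ ≡ σ [ x ]≔ evalA a σ)

  data IL : Assn → Reg → Assn → Set₁ where
    assign : (P : Pred Store 0ℓ) (x : Var) (a : AExp) →
             IL (okA P) (atom (x ≔ a)) (okA (sp x a P))
    assume : (P : Pred Store 0ℓ) (b : BExp) →
             IL (okA P) (atom (b ¿)) (okA (P ∩ Holds b))
    nondet : (P : Pred Store 0ℓ) (x : Var) →
             IL (okA P) (atom (nondet x)) (okA (exA x P))
    skip   : (P : Pred Store 0ℓ) → IL (okA P) (atom skip) (okA P)
    er-id  : (P : Pred Store 0ℓ) (r : Reg) → IL (erA P) r (erA P)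
    disj   : ∀ {P₁ P₂ Q₁ Q₂ r} → IL P₁ r Q₁ → IL P₂ r Q₂ → IL (P₁ ∪ P₂) r (Q₁ ∪ Q₂)
    cons   : ∀ {P P' Q Q' r} → IL P' r Q' → P' ⊆ P → Q ⊆ Q' → IL P r Q
    seq    : ∀ {P R Q r₁ r₂} → IL P r₁ R → IL R r₂ Q → IL P (r₁ ⨾ r₂) Q
    choiceL : ∀ {P Q r₁ r₂} → IL P r₁ Q → IL P (r₁ ⊞ r₂) Q
    choiceR : ∀ {P Q r₁ r₂} → IL P r₂ Q → IL P (r₁ ⊞ r₂) Q
    iter0  : (P : Assn) (r : Reg) → IL P (r ⋆) P
    unroll : ∀ {P Q r} → IL P ((r ⋆) ⨾ r) Q → IL P (r ⋆) Q

  data UT : ∀ {P r Q} → IL P r Q → Assn → Assn → Set₁ where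
    assign : ∀ {P x a} {Q' : Pred Store 0ℓ} → Q' ⊆ sp x a P →
             UT (assign P x a) (okA (P ∩ substA Q' a x)) (okA Q')
    nondet : ∀ {P x} {Q' : Pred Store 0ℓ} → Q' ⊆ exA x P →
             UT (nondet P x) (okA (P ∩ exA x Q')) (okA Q')
    assume : ∀ {P b} {Q' : Pred Store 0ℓ} → Q' ⊆ P ∩ Holds b →
             UT (assume P b) (okA Q') (okA Q')
    skip   : ∀ {P} {Q' : Assn} → Q' ⊆ okA P → UT (skip P) Q' Q'
    er-id  : ∀ {P r} {Q' : Pred Store 0ℓ} → Q' ⊆ P →
             UT (er-id P r) (erA Q') (erA Q')
    empty  : ∀ {P r Q} (d : IL P r Q) → UT d ∅ ∅
    disj   : ∀ {P₁ P₂ Q₁ Q₂ r} {d₁ : IL P₁ r Q₁} {d₂ : IL P₂ r Q₂}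
               {P₁' P₂' Q₁' Q₂' : Assn} →
             UT d₁ P₁' Q₁' → UT d₂ P₂' Q₂' →
             UT (disj d₁ d₂) (P₁' ∪ P₂') (Q₁' ∪ Q₂')
    seq    : ∀ {P R Q r₁ r₂} {d₁ : IL P r₁ R} {d₂ : IL R r₂ Q} {P' R' Q' : Assn} →
             UT d₁ P' R' → UT d₂ R' Q' → UT (seq d₁ d₂) P' Q'
    choiceL : ∀ {P Q r₁ r₂} {d : IL P r₁ Q} {P' Q' : Assn} →
              UT d P' Q' → UT (choiceL {r₂ = r₂} d) P' Q'
    choiceR : ∀ {P Q r₁ r₂} {d : IL P r₂ Q} {P' Q' : Assn} →
              UT d P' Q' → UT (choiceR {r₁ = r₁} d) P' Q'
    iter0  : ∀ {P r} {Q' : Assn} → Q' ⊆ P → UT (iter0 P r) Q' Q'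
    unroll : ∀ {P Q r} {d : IL P ((r ⋆) ⨾ r) Q} {P' Q' : Assn} →
             UT d P' Q' → UT (unroll d) P' Q'
    consIL : ∀ {P P₀ Q Q₀ r} {d : IL P₀ r Q₀} {p : P₀ ⊆ P} {q : Q ⊆ Q₀}
               {P'' Q'' : Assn} →
             UT d P'' Q'' → Q'' ⊆ Q → UT (cons {P = P} {Q = Q} d p q) P'' Q''
    consSIL : ∀ {P Q r} {d : IL P r Q} {P' Q' P'' Q'' : Assn} →
              UT d P'' Q'' → ¬ Empty P' → P' ⊆ P'' → Q'' ⊆ Q' → Q' ⊆ Q →
              UT d P' Q'

-- By induction on the U-Turn derivation: every rule is an instance of a
-- sound SIL rule, and its assertions are carved out of those of the IL proof
-- tree it is attached to. P' and Q' are empty together: a state of P' has a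
-- successor in Q' by SIL validity, and conversely the atomic rules demand
-- that Q' lie in the IL postcondition computed from P, so every state of Q'
-- has a predecessor in P' (consSIL asks outright for a nonempty P').
-- Excluded middle is used only to decide whether P' is empty.
module Submission where

open import Defs
open import Level using (0ℓ)
open import Data.Nat using (ℕ)
open import Data.Product using (_×_; _,_; proj₁; proj₂)
open import Data.Sum using (_⊎_; inj₁; inj₂)
open import Data.Integer using (ℤ)
open import Data.Vec using (lookup; _[_]≔_)
open import Data.Vec.Properties using ([]≔-idempotent; []≔-lookup)
open import Function using (_∘_)
open import Relation.Nullary using (¬_; Dec; yes; no; contradiction)
open import Relation.Unary using (_⊆_; Empty; _∪_)
open import Relation.Binary.PropositionalEquality using (_≡_; refl; sym; trans; subst)
open import Axiom.ExcludedMiddle using (ExcludedMiddle)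

dec-both-or-neither : ∀ {A B : Set} → Dec A → (A → B) → (B → A) →
                      (A × B) ⊎ (¬ A × ¬ B)
dec-both-or-neither (yes a) a⇒b _   = inj₁ (a , a⇒b a)
dec-both-or-neither (no ¬a) _   b⇒a = inj₂ (¬a , ¬a ∘ b⇒a)

module _ {k : ℕ} where
  open Lang k

  []≔-restore : ∀ (σ : Store) x (v : ℤ) → (σ [ x ]≔ v) [ x ]≔ lookup σ x ≡ σ
  []≔-restore σ x v = trans ([]≔-idempotent σ x) ([]≔-lookup σ x)

  Sem-er : ∀ r σ → Sem r (er , σ) (er , σ)
  Sem-er (atom c)  σ = erS
  Sem-er (r₁ ⨾ r₂) σ = seqS (Sem-er r₁ σ) (Sem-er r₂ σ)
  Sem-er (r₁ ⊞ r₂) σ = choiceLS (Sem-er r₁ σ)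
  Sem-er (r ⋆)     σ = starS 0 pow0

  Sem-skip : ∀ s → Sem (atom skip) s s
  Sem-skip (ok , σ) = skipS
  Sem-skip (er , σ) = erS

  Sem-⋆-snoc : ∀ {r s t} → Sem ((r ⋆) ⨾ r) s t → Sem (r ⋆) s t
  Sem-⋆-snoc (seqS (starS _ rⁿ) r₁) = starS _ (powS rⁿ r₁)

  nondet-restores : ∀ σ x v → Sem (atom (nondet x)) (ok , σ [ x ]≔ v) (ok , σ)
  nondet-restores σ x v =
    subst (Sem (atom (nondet x)) (ok , σ [ x ]≔ v) ∘ (ok ,_))
          ([]≔-restore σ x v) (nondetS (lookup σ x))

  Back-skip : ∀ {Q} → Q ⊆ Back (atom skip) Q
  Back-skip {x = s} q = s , q , Sem-skip s

  Back-er : ∀ {Q r} → erA Q ⊆ Back r (erA Q)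
  Back-er {r = r} {er , σ} q = (er , σ) , q , Sem-er r σ

  Back-⋆ : ∀ {Q r} → Q ⊆ Back (r ⋆) Q
  Back-⋆ {x = s} q = s , q , starS 0 pow0

  SILValid-cons : ∀ {P P' Q Q' r} → P ⊆ P' → SILValid P' r Q' → Q' ⊆ Q → SILValid P r Q
  SILValid-cons P⊆P' valid Q'⊆Q p with valid (P⊆P' p)
  ... | t , q , s→t = t , Q'⊆Q q , s→t

  SILValid-∪ : ∀ {P₁ P₂ Q₁ Q₂ r} → SILValid P₁ r Q₁ → SILValid P₂ r Q₂ →
               SILValid (P₁ ∪ P₂) r (Q₁ ∪ Q₂)
  SILValid-∪ valid₁ _ (inj₁ p) with valid₁ p
  ... | t , q , s→t = t , inj₁ q , s→t
  SILValid-∪ _ valid₂ (inj₂ p) with valid₂ p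
  ... | t , q , s→t = t , inj₂ q , s→t

  SILValid-seq : ∀ {P R Q r₁ r₂} → SILValid P r₁ R → SILValid R r₂ Q → SILValid P (r₁ ⨾ r₂) Q
  SILValid-seq valid₁ valid₂ p with valid₁ p
  ... | t , rt , s→t with valid₂ rt
  ...   | u , qu , t→u = u , qu , seqS s→t t→u

  SILValid-⊞ˡ : ∀ {P Q r₁ r₂} → SILValid P r₁ Q → SILValid P (r₁ ⊞ r₂) Q
  SILValid-⊞ˡ valid p with valid p
  ... | t , q , s→t = t , q , choiceLS s→t

  SILValid-⊞ʳ : ∀ {P Q r₁ r₂} → SILValid P r₂ Q → SILValid P (r₁ ⊞ r₂) Q
  SILValid-⊞ʳ valid p with valid p
  ... | t , q , s→t = t , q , choiceRS s→t

  SILValid-unroll : ∀ {P Q r} → SILValid P ((r ⋆) ⨾ r) Q → SILValid P (r ⋆) Q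
  SILValid-unroll valid p with valid p
  ... | t , q , s→t = t , q , Sem-⋆-snoc s→t

  SILValid-Empty : ∀ {P Q r} → SILValid P r Q → Empty Q → Empty P
  SILValid-Empty valid Q-empty s p with valid p
  ... | t , q , _ = Q-empty t q

  UT-sound : ∀ {P Q r} {d : IL P r Q} {P' Q'} → UT d P' Q' → SILValid P' r Q'
  UT-sound (assign _) {ok , σ} (_ , q) = _ , q , assignS
  UT-sound (nondet _) {ok , _} (_ , σ , v , q , refl) = (ok , σ) , q , nondet-restores σ _ v
  UT-sound (assume Q'⊆P∩b) {ok , σ} q = (ok , σ) , q , assumeS (proj₂ (Q'⊆P∩b q))
  UT-sound (skip _)     = Back-skip
  UT-sound (er-id _)    = Back-er
  UT-sound (empty _)    = λ ()
  UT-sound (disj u₁ u₂) = SILValid-∪ (UT-sound u₁) (UT-sound u₂)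
  UT-sound (seq u₁ u₂)  = SILValid-seq (UT-sound u₁) (UT-sound u₂)
  UT-sound (choiceL u)  = SILValid-⊞ˡ (UT-sound u)
  UT-sound (choiceR u)  = SILValid-⊞ʳ (UT-sound u)
  UT-sound (iter0 _)    = Back-⋆
  UT-sound (unroll u)   = SILValid-unroll (UT-sound u)
  UT-sound (consIL u _) = UT-sound u
  UT-sound (consSIL u _ P'⊆P'' Q''⊆Q' _) = SILValid-cons P'⊆P'' (UT-sound u) Q''⊆Q'

  UT-pre-⊆ : ∀ {P Q r} {d : IL P r Q} {P' Q'} → UT d P' Q' → P' ⊆ P
  UT-pre-⊆ (assign _) {ok , σ}      = proj₁
  UT-pre-⊆ (nondet _) {ok , σ}      = proj₁
  UT-pre-⊆ (assume Q'⊆P∩b) {ok , σ} = proj₁ ∘ Q'⊆P∩b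
  UT-pre-⊆ (skip Q'⊆P)              = Q'⊆P
  UT-pre-⊆ (er-id Q'⊆P) {er , σ}    = Q'⊆P
  UT-pre-⊆ (empty _)                = λ ()
  UT-pre-⊆ (disj u₁ _) (inj₁ p)     = inj₁ (UT-pre-⊆ u₁ p)
  UT-pre-⊆ (disj _ u₂) (inj₂ p)     = inj₂ (UT-pre-⊆ u₂ p)
  UT-pre-⊆ (seq u₁ _)               = UT-pre-⊆ u₁
  UT-pre-⊆ (choiceL u)              = UT-pre-⊆ u
  UT-pre-⊆ (choiceR u)              = UT-pre-⊆ u
  UT-pre-⊆ (iter0 Q'⊆P)             = Q'⊆P
  UT-pre-⊆ (unroll u)               = UT-pre-⊆ u
  UT-pre-⊆ (consIL {p = P₀⊆P} u _)  = P₀⊆P ∘ UT-pre-⊆ u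
  UT-pre-⊆ (consSIL u _ P'⊆P'' _ _) = UT-pre-⊆ u ∘ P'⊆P''

  UT-post-⊆ : ∀ {P Q r} {d : IL P r Q} {P' Q'} → UT d P' Q' → Q' ⊆ Q
  UT-post-⊆ (assign Q'⊆sp) {ok , σ}  = Q'⊆sp
  UT-post-⊆ (nondet Q'⊆∃P) {ok , σ}  = Q'⊆∃P
  UT-post-⊆ (assume Q'⊆P∩b) {ok , σ} = Q'⊆P∩b
  UT-post-⊆ (skip Q'⊆P)              = Q'⊆P
  UT-post-⊆ (er-id Q'⊆P) {er , σ}    = Q'⊆P
  UT-post-⊆ (empty _)                = λ ()
  UT-post-⊆ (disj u₁ _) (inj₁ q)     = inj₁ (UT-post-⊆ u₁ q)
  UT-post-⊆ (disj _ u₂) (inj₂ q)     = inj₂ (UT-post-⊆ u₂ q)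
  UT-post-⊆ (seq _ u₂)               = UT-post-⊆ u₂
  UT-post-⊆ (choiceL u)              = UT-post-⊆ u
  UT-post-⊆ (choiceR u)              = UT-post-⊆ u
  UT-post-⊆ (iter0 Q'⊆P)             = Q'⊆P
  UT-post-⊆ (unroll u)               = UT-post-⊆ u
  UT-post-⊆ (consIL _ Q''⊆Q)         = Q''⊆Q
  UT-post-⊆ (consSIL _ _ _ _ Q'⊆Q)   = Q'⊆Q

  UT-Empty-pre⇒Empty-post : ∀ {P Q r} {d : IL P r Q} {P' Q'} → UT d P' Q' → Empty P' → Empty Q'
  UT-Empty-pre⇒Empty-post (assign Q'⊆sp) P'-empty (ok , τ) q with Q'⊆sp q
  ... | σ , p , refl = P'-empty (ok , σ) (p , q)
  UT-Empty-pre⇒Empty-post (nondet Q'⊆∃P) P'-empty (ok , τ) q with Q'⊆∃P q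
  ... | σ , v , p , refl = P'-empty (ok , σ) (p , τ , lookup σ _ , q , sym ([]≔-restore σ _ v))
  UT-Empty-pre⇒Empty-post (assume _) = λ P'-empty → P'-empty
  UT-Empty-pre⇒Empty-post (skip _)   = λ P'-empty → P'-empty
  UT-Empty-pre⇒Empty-post (er-id _)  = λ P'-empty → P'-empty
  UT-Empty-pre⇒Empty-post (empty _) _ _ ()
  UT-Empty-pre⇒Empty-post (disj u₁ _) P'-empty t (inj₁ q) =
    UT-Empty-pre⇒Empty-post u₁ (λ s → P'-empty s ∘ inj₁) t q
  UT-Empty-pre⇒Empty-post (disj _ u₂) P'-empty t (inj₂ q) =
    UT-Empty-pre⇒Empty-post u₂ (λ s → P'-empty s ∘ inj₂) t q
  UT-Empty-pre⇒Empty-post (seq u₁ u₂)  =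
    UT-Empty-pre⇒Empty-post u₂ ∘ UT-Empty-pre⇒Empty-post u₁
  UT-Empty-pre⇒Empty-post (choiceL u)  = UT-Empty-pre⇒Empty-post u
  UT-Empty-pre⇒Empty-post (choiceR u)  = UT-Empty-pre⇒Empty-post u
  UT-Empty-pre⇒Empty-post (iter0 _)    = λ P'-empty → P'-empty
  UT-Empty-pre⇒Empty-post (unroll u)   = UT-Empty-pre⇒Empty-post u
  UT-Empty-pre⇒Empty-post (consIL u _) = UT-Empty-pre⇒Empty-post u
  UT-Empty-pre⇒Empty-post (consSIL _ P'-nonempty _ _ _) P'-empty =
    contradiction P'-empty P'-nonempty

theorem4p2 : (k : ℕ) → ExcludedMiddle 0ℓ →
    let open Lang k in
    ∀ {P Q : Assn} {r : Reg} (d : IL P r Q) {P' Q' : Assn} →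
    UT d P' Q' →
    SILValid P' r Q' × P' ⊆ P × Q' ⊆ Q ×
      ((Empty P' × Empty Q') ⊎ (¬ Empty P' × ¬ Empty Q'))
theorem4p2 k em d u =
  UT-sound u , UT-pre-⊆ u , UT-post-⊆ u ,
  dec-both-or-neither em (UT-Empty-pre⇒Empty-post u) (SILValid-Empty (UT-sound u))
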